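{- Let $x\in W$ with $\mathrm{lev}(x)>0$ and let $\nu\in\Phi_{\mathrm{fin}}$. Then $\Gamma_{x,\nu}$ has only finitely many corners.
   Context: Setting: $\Phi_{\mathrm{fin}}$ irreducible simply laced finite root system, pairing $\langle\,,\rangle$ with $\langle\nu,\nu\rangle=2$, root lattice $Q$, weight lattice $P$, Weyl group $W_{\mathrm{fin}}$. Affine roots $\nu+r\delta$ ($\nu\in\Phi_{\mathrm{fin}},r\in\mathbb{Z}$), positive iff $r>0$ or ($r=0$ and $\nu>0$). $X=P\oplus\mathbb{Z}\delta\oplus\mathbb{Z}\Lambda_0$, level of $\mu+m\delta+l\Lambda_0$ is $l$; $\langle\mu+m\delta+l\Lambda_0,\nu+r\delta\rangle=\langle\mu,\nu\rangle+lr$. $W_{\mathrm{aff}}=\{Y^\lambda w:\lambda\in Q,w\in W_{\mathrm{fin}}\}$ acts on affine roots by $Y^\lambda w(\nu+r\delta)=w(\nu)+(r-\langle\lambda,w(\nu)\rangle)\delta$. Tits cone $\mathcal T=\{m\delta\}\cup\{\text{positive level elements of }X\}$; $W=\{X^\zeta\tilde w:\zeta\in\mathcal T,\tilde w\in W_{\mathrm{aff}}\}$, $\mathrm{lev}(X^\zeta\tilde w)=\mathrm{lev}(\zeta)$. Double affine roots $\tilde\alpha+j\pi$; positive if $\tilde\alpha>0,j\ge0$ or $\tilde\alpha<0,j>0$, negative otherwise. $X\rtimes W_{\mathrm{aff}}$ acts on double affine roots by $X^\zeta\tilde w(\tilde\alpha+j\pi)=\tilde w(\tilde\alpha)+(j-\langle\zeta,\tilde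 w(\tilde\alpha)\rangle)\pi$. $\Gamma_{x,\nu}=\{(r,j)\in\mathbb{Z}^2:\nu+r\delta+j\pi\text{ positive and }x^{ -1}(\nu+r\delta+j\pi)\text{ negative}\}$. The root $\nu+r\delta+j\pi$ is a corner of $\Gamma_{x,\nu}$ if $(r,j)\in\Gamma_{x,\nu}$ and for every $(p,q)\in\Gamma_{x,\nu}$ with $(p,q)\ne(r,j)$, $(2r-p,2j-q)\notin\Gamma_{x,\nu}$. -}

module Defs where

open import Data.Nat using (ℕ; zero; suc; _≤_)
open import Data.Integer using (ℤ; +_; -[1+_]; _+_; _-_; _*_; -_) renaming (_≤_ to _≤ℤ_; _<_ to _<ℤ_)
open import Data.Fin using (Fin; zero; suc)
open import Data.Fin.Properties using () renaming (_≟_ to _≟F_)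
open import Data.Bool using (Bool)
open import Data.List using (List; []; _∷_; reverse)
open import Data.Product using (Σ; ∃; _×_; _,_)
open import Data.Sum using (_⊎_)
open import Relation.Nullary using (¬_; yes; no)
open import Relation.Binary.PropositionalEquality using (_≡_; _≢_)

sumFin : ∀ {n} → (Fin n → ℤ) → ℤ
sumFin {zero}  f = + 0
sumFin {suc n} f = f zero + sumFin (λ i → f (suc i))

-- Simply laced Cartan data.  The root lattice Q is ℤ^n in the basis of
-- simple roots α_1..α_n; the pairing on Q is given by the Cartan matrix.

Vecℤ : ℕ → Set
Vecℤ n = Fin n → ℤ

bil : ∀ {n} → (Fin n → Fin n → ℤ) → Vecℤ n → Vecℤ n → ℤ
bil A u v = sumFin (λ i → sumFin (λ j → u i * (A i j * v j)))

-- Cartan matrix of an irreducible simply laced finite root system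
-- (i.e. a connected ADE Dynkin diagram).
record SimplyLacedCartan (n : ℕ) : Set where
  field
    A         : Fin n → Fin n → ℤ
    nonempty  : 1 ≤ n
    diag      : ∀ i → A i i ≡ + 2
    offdiag   : ∀ i j → i ≢ j → (A i j ≡ + 0) ⊎ (A i j ≡ -[1+ 0 ])
    symm      : ∀ i j → A i j ≡ A j i
    posdef    : ∀ (v : Vecℤ n) → (∃ λ k → v k ≢ + 0) → + 0 <ℤ bil A v v
    connected : ∀ (S : Fin n → Bool) → (∀ i j → S i ≢ S j → A i j ≡ + 0) →
                ∀ i j → S i ≡ S j

module RootData {n : ℕ} (C : SimplyLacedCartan n) where
  open SimplyLacedCartan C

  ⟪_,_⟫ : Vecℤ n → Vecℤ n → ℤ
  ⟪ u , v ⟫ = bil A u v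

  simple : Fin n → Vecℤ n
  simple i k with k ≟F i
  ... | yes _ = + 1
  ... | no  _ = + 0

  refl : Fin n → Vecℤ n → Vecℤ n
  refl i v k = v k - ⟪ v , simple i ⟫ * simple i k

  -- Elements of W_fin given as words in simple reflections;
  -- the word i₁ ∷ i₂ ∷ … denotes s_{i₁} s_{i₂} ⋯
  WordFin : Set
  WordFin = List (Fin n)

  actFin : WordFin → Vecℤ n → Vecℤ n
  actFin []      v = v
  actFin (i ∷ w) v = refl i (actFin w v)

  -- inverse element (simple reflections are involutions)
  invFin : WordFin → WordFin
  invFin = reverse

  IsRoot : Vecℤ n → Set
  IsRoot ν = Σ WordFin λ w → Σ (Fin n) λ i → ∀ k → ν k ≡ actFin w (simple i) k

  PosFin NegFin : Vecℤ n → Set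
  PosFin ν = ∀ k → + 0 ≤ℤ ν k
  NegFin ν = ∀ k → ν k ≤ℤ + 0

  -- weight lattice P in the basis of fundamental weights ω_i,
  -- ⟨ω_i , α_j⟩ = δ_ij;  pairing P × Q
  Weight : Set
  Weight = Vecℤ n

  ⟪_,_⟫PQ : Weight → Vecℤ n → ℤ
  ⟪ μ , ν ⟫PQ = sumFin (λ i → μ i * ν i)

  -- X = P ⊕ ℤδ ⊕ ℤΛ₀ ;  element μ + mδ + lΛ₀
  record XElt : Set where
    constructor xelt
    field
      μ : Weight
      m : ℤ
      l : ℤ

  negX : XElt → XElt
  negX (xelt μ m l) = xelt (λ i → - μ i) (- m) (- l)

  -- double affine root ν + rδ + jπ
  record DRoot : Set where
    constructor droot
    field
      ν : Vecℤ n
      r : ℤ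
      j : ℤ

  pairX : XElt → Vecℤ n → ℤ → ℤ
  pairX (xelt μ m l) ν r = ⟪ μ , ν ⟫PQ + l * r

  actXζ : XElt → DRoot → DRoot
  actXζ ζ (droot ν r j) = droot ν r (j - pairX ζ ν r)

  actY : Vecℤ n → DRoot → DRoot
  actY λ' (droot ν r j) = droot ν (r - ⟪ λ' , ν ⟫) j

  actW : WordFin → DRoot → DRoot
  actW w (droot ν r j) = droot (actFin w ν) r j

  -- element X^ζ Y^λ w of W (ζ ∈ Tits cone, λ ∈ Q, w ∈ W_fin)
  record WElt : Set where
    constructor welt
    field
      ζ  : XElt
      λQ : Vecℤ n
      w  : WordFin

  level : WElt → ℤ
  level x = XElt.l (WElt.ζ x)

  -- x⁻¹ = w⁻¹ Y^{-λ} X^{-ζ}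
  actInv : WElt → DRoot → DRoot
  actInv (welt ζ λ' w) β = actW (invFin w) (actY (λ k → - λ' k) (actXζ (negX ζ) β))

  AffPos AffNeg : Vecℤ n → ℤ → Set
  AffPos ν r = (+ 0 <ℤ r) ⊎ ((r ≡ + 0) × PosFin ν)
  AffNeg ν r = (r <ℤ + 0) ⊎ ((r ≡ + 0) × NegFin ν)

  DPos DNeg : DRoot → Set
  DPos (droot ν r j) = (AffPos ν r × (+ 0 ≤ℤ j)) ⊎ (AffNeg ν r × (+ 0 <ℤ j))
  DNeg β = ¬ DPos β

  Γ : WElt → Vecℤ n → ℤ → ℤ → Set
  Γ x ν r j = DPos (droot ν r j) × DNeg (actInv x (droot ν r j))

  Corner : WElt → Vecℤ n → ℤ → ℤ → Set
  Corner x ν r j =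
    Γ x ν r j ×
    (∀ p q → Γ x ν p q → ¬ ((p ≡ r) × (q ≡ j)) →
       ¬ Γ x ν ((+ 2 * r) - p) ((+ 2 * j) - q))

module Submission where

-- Write β = ν + rδ + jπ and x = X^ζ Y^λ w with ζ = μ + mδ + lΛ₀, l > 0. Then
-- x⁻¹β = w⁻¹ν + (r - a)δ + hπ with a = ⟨-λ, ν⟩ and height h = j - c + l r, c = ⟨-μ, ν⟩. A corner cannot have both vertical
-- neighbours (r, j ± 1) in Γ, which confines it to the rows j = 0, 1 or to the two lines h = 0, -1.
-- Far to the left the neighbours (r ± 1, 1), resp. (r ± 1, j ∓ l), are both in Γ, and far to the
-- right Γ is empty. So the corners lie in finitely many columns, at most four in each.

open import Defs
open import Data.Nat using (ℕ)
open import Data.Integer using (ℤ; +_) renaming (_<_ to _<ℤ_)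
open import Data.Product using (Σ; _×_; _,_)
open import Data.List using (List)
open import Data.List.Membership.Propositional using (_∈_)
open import Relation.Binary.PropositionalEquality using (_≡_)

open import Data.Nat using (suc; s≤s; z<s)
open import Data.Integer using (-[1+_]; +≤+; -≤-; +<+; -<+; _+_; _-_; _*_; -_; _≤_; _<_; _⊓_; _⊔_; ∣_∣; _≤?_; nonNegative; nonPositive)
open import Data.Integer.Properties
open import Data.Integer.Tactic.RingSolver using (solve-∀)
open import Data.Product using (proj₁; proj₂)
open import Data.Sum using (_⊎_; inj₁; inj₂)
open import Data.Empty using (⊥-elim)
open import Data.List using ([]; _∷_; map; concatMap; applyUpTo)
open import Data.List.Relation.Unary.Any using (here; there)
open import Data.List.Membership.Propositional using (lose)
open import Data.List.Membership.Propositional.Properties using (∈-map⁺; ∈-concatMap⁺; ∈-applyUpTo⁺)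
open import Function using (_∘_)
open import Relation.Nullary using (¬_; yes; no)
open import Relation.Binary.PropositionalEquality using (_≢_; refl; sym; trans; cong; subst; subst₂; module ≡-Reasoning)

i<j⇒i-j<0 : ∀ {i j} → i < j → i - j < + 0
i<j⇒i-j<0 {i} {j} i<j = subst (i - j <_) (+-inverseʳ j) (+-monoˡ-< (- j) i<j)

i<j⇒0<j-i : ∀ {i j} → i < j → + 0 < j - i
i<j⇒0<j-i {i} {j} i<j = subst (_< j - i) (+-inverseʳ i) (+-monoˡ-< (- i) i<j)

i-j+j≡i : ∀ i j → (i - j) + j ≡ i
i-j+j≡i = solve-∀

i-j<0⇒i<j : ∀ {i j} → i - j < + 0 → i < j
i-j<0⇒i<j {i} {j} i-j<0 = subst₂ _<_ (i-j+j≡i i j) (+-identityˡ j) (+-monoˡ-< j i-j<0)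

0<i-j⇒j<i : ∀ {i j} → + 0 < i - j → j < i
0<i-j⇒j<i {i} {j} 0<i-j = subst₂ _<_ (+-identityˡ j) (i-j+j≡i i j) (+-monoˡ-< j 0<i-j)

0≤i≤1⇒i≡0∨i≡1 : ∀ {i} → + 0 ≤ i → i ≤ + 1 → i ≡ + 0 ⊎ i ≡ + 1
0≤i≤1⇒i≡0∨i≡1 {+ 0} _ _ = inj₁ refl
0≤i≤1⇒i≡0∨i≡1 {+ 1} _ _ = inj₂ refl
0≤i≤1⇒i≡0∨i≡1 {+ suc (suc _)} _ (+≤+ (s≤s ()))

-1≤i≤0⇒i≡0∨i≡-1 : ∀ {i} → -[1+ 0 ] ≤ i → i ≤ + 0 → i ≡ + 0 ⊎ i ≡ -[1+ 0 ]
-1≤i≤0⇒i≡0∨i≡-1 {+ 0} _ _ = inj₁ refl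
-1≤i≤0⇒i≡0∨i≡-1 { -[1+ 0 ]} _ _ = inj₂ refl
-1≤i≤0⇒i≡0∨i≡-1 { -[1+ suc _ ]} (-≤- ()) _
-1≤i≤0⇒i≡0∨i≡-1 {+ suc _} _ (+≤+ ())

i≤l*i : ∀ {l i} → + 0 < l → + 0 ≤ i → i ≤ l * i
i≤l*i {l} {i} 0<l 0≤i = subst (_≤ l * i) (*-identityˡ i)
  (*-monoʳ-≤-nonNeg i {{nonNegative 0≤i}} (i<j⇒suc[i]≤j 0<l))

l*i≤i : ∀ {l i} → + 0 < l → i ≤ + 0 → l * i ≤ i
l*i≤i {l} {i} 0<l i≤0 = subst (l * i ≤_) (*-identityˡ i)
  (*-monoʳ-≤-nonPos i {{nonPositive i≤0}} (i<j⇒suc[i]≤j 0<l))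

i+1≢i : ∀ i → i + + 1 ≢ i
i+1≢i i i+1≡i = i≢suc[i] (sym (trans (+-comm (+ 1) i) i+1≡i))

i-1≤i+1 : ∀ i → i - + 1 ≤ i + + 1
i-1≤i+1 i = i≤j⇒i-k≤j (+ 1) (i≤i+j i (+ 1))

i-k≡2i-[i+k] : ∀ i k → i - k ≡ + 2 * i - (i + k)
i-k≡2i-[i+k] = solve-∀

1<i⇒0<i+1 : ∀ {i} → + 1 < i → + 0 < i + + 1
1<i⇒0<i+1 1<i = <-trans (+<+ z<s) (+-monoˡ-< (+ 1) 1<i)

1<i⇒0<i-1 : ∀ {i} → + 1 < i → + 0 < i - + 1
1<i⇒0<i-1 1<i = +-monoˡ-< (- + 1) 1<i

interval : ℤ → ℤ → List ℤ
interval lo hi = applyUpTo (λ k → lo + + k) (suc ∣ hi - lo ∣)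

∈-interval : ∀ {lo hi i} → lo ≤ i → i ≤ hi → i ∈ interval lo hi
∈-interval {lo} {hi} {i} lo≤i i≤hi =
  subst (_∈ interval lo hi) lo+∣i-lo∣≡i (∈-applyUpTo⁺ (λ k → lo + + k) (s≤s ∣i-lo∣≤∣hi-lo∣))
  where
  +∣i-lo∣≡i-lo : + ∣ i - lo ∣ ≡ i - lo
  +∣i-lo∣≡i-lo = 0≤i⇒+∣i∣≡i (i≤j⇒0≤j-i lo≤i)
  +∣hi-lo∣≡hi-lo : + ∣ hi - lo ∣ ≡ hi - lo
  +∣hi-lo∣≡hi-lo = 0≤i⇒+∣i∣≡i (i≤j⇒0≤j-i (≤-trans lo≤i i≤hi))
  ∣i-lo∣≤∣hi-lo∣ : ∣ i - lo ∣ Data.Nat.≤ ∣ hi - lo ∣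
  ∣i-lo∣≤∣hi-lo∣ = drop‿+≤+ (subst₂ _≤_ (sym +∣i-lo∣≡i-lo) (sym +∣hi-lo∣≡hi-lo) (+-monoˡ-≤ (- lo) i≤hi))
  lo+[i-lo]≡i : ∀ lo i → lo + (i - lo) ≡ i
  lo+[i-lo]≡i = solve-∀
  lo+∣i-lo∣≡i : lo + + ∣ i - lo ∣ ≡ i
  lo+∣i-lo∣≡i = trans (cong (_+_ lo) +∣i-lo∣≡i-lo) (lo+[i-lo]≡i lo i)

bounded-with-finite-fibres⇒listed :
  ∀ {P : ℤ → ℤ → Set} (lo hi : ℤ) (fibre : ℤ → List ℤ) →
  (∀ {r j} → P r j → lo ≤ r × r ≤ hi × j ∈ fibre r) →
  Σ (List (ℤ × ℤ)) λ L → ∀ r j → P r j → (r , j) ∈ L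
bounded-with-finite-fibres⇒listed lo hi fibre bounded =
  concatMap row (interval lo hi) , λ r j p →
    let (lo≤r , r≤hi , j∈fibre) = bounded p in
    ∈-concatMap⁺ row (lose (∈-interval lo≤r r≤hi) (∈-map⁺ (r ,_) j∈fibre))
  where
  row : ℤ → List (ℤ × ℤ)
  row r = map (r ,_) (fibre r)

module Positivity {n : ℕ} (C : SimplyLacedCartan n) where
  open RootData C using (DPos; droot)

  DPos⇒0≤j : ∀ {ν r j} → DPos (droot ν r j) → + 0 ≤ j
  DPos⇒0≤j (inj₁ (_ , 0≤j)) = 0≤j
  DPos⇒0≤j (inj₂ (_ , 0<j)) = <⇒≤ 0<j

  j<0⇒¬DPos : ∀ {ν r j} → j < + 0 → ¬ DPos (droot ν r j)
  j<0⇒¬DPos j<0 β>0 = <⇒≱ j<0 (DPos⇒0≤j β>0)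

  r<0⇒DPos⇒0<j : ∀ {ν r j} → r < + 0 → DPos (droot ν r j) → + 0 < j
  r<0⇒DPos⇒0<j r<0 (inj₁ (inj₁ 0<r , _)) = ⊥-elim (<-asym 0<r r<0)
  r<0⇒DPos⇒0<j r<0 (inj₁ (inj₂ (refl , _) , _)) = ⊥-elim (<-irrefl refl r<0)
  r<0⇒DPos⇒0<j _ (inj₂ (_ , 0<j)) = 0<j

  r<0⇒j≤0⇒¬DPos : ∀ {ν r j} → r < + 0 → j ≤ + 0 → ¬ DPos (droot ν r j)
  r<0⇒j≤0⇒¬DPos r<0 j≤0 β>0 = ≤⇒≯ j≤0 (r<0⇒DPos⇒0<j r<0 β>0)

  0<r⇒0≤j⇒DPos : ∀ {ν r j} → + 0 < r → + 0 ≤ j → DPos (droot ν r j)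
  0<r⇒0≤j⇒DPos 0<r 0≤j = inj₁ (inj₁ 0<r , 0≤j)

  r<0⇒0<j⇒DPos : ∀ {ν r j} → r < + 0 → + 0 < j → DPos (droot ν r j)
  r<0⇒0<j⇒DPos r<0 0<j = inj₂ (inj₁ r<0 , 0<j)

  DPos-raise : ∀ {ν r j k} → DPos (droot ν r j) → + 0 < k → DPos (droot ν r k)
  DPos-raise (inj₁ (affine , _)) 0<k = inj₁ (affine , <⇒≤ 0<k)
  DPos-raise (inj₂ (affine , _)) 0<k = inj₂ (affine , 0<k)

module CornerAnalysis {n : ℕ} (C : SimplyLacedCartan n) (x : RootData.WElt C) (ν : Vecℤ n)
                      (0<l : + 0 < RootData.level C x) where
  open RootData C using (WElt; XElt; ⟪_,_⟫; ⟪_,_⟫PQ; Γ; Corner)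
  open Positivity C
  open WElt x using (ζ; λQ)
  open XElt ζ using (μ; l)
  open ≡-Reasoning

  -- x⁻¹ (ν + rδ + jπ) reduces to w⁻¹ν + (r - a)δ + (height r j)π, so Γ x ν r j unfolds
  -- definitionally to DPos (droot ν r j) × ¬ DPos (droot (w⁻¹ν) (r - a) (height r j)).
  a c : ℤ
  a = ⟪ (λ k → - λQ k) , ν ⟫
  c = ⟪ (λ k → - μ k) , ν ⟫PQ

  line : ℤ → ℤ
  line r = c + - l * r

  height : ℤ → ℤ → ℤ
  height r j = j - line r

  j≡height+line : ∀ r j → j ≡ height r j + line r
  j≡height+line r j = sym (i-j+j≡i j (line r))

  line≤c-r : ∀ {r} → + 0 ≤ r → line r ≤ c - r
  line≤c-r {r} 0≤r = subst (_≤ c - r) (cong (_+_ c) (neg-distribˡ-* l r))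
    (+-monoʳ-≤ c (neg-mono-≤ (i≤l*i 0<l 0≤r)))

  c-r≤line : ∀ {r} → r ≤ + 0 → c - r ≤ line r
  c-r≤line {r} r≤0 = subst (c - r ≤_) (cong (_+_ c) (neg-distribˡ-* l r))
    (+-monoʳ-≤ c (neg-mono-≤ (l*i≤i 0<l r≤0)))

  ¬Corner-vertical : ∀ {r j} → Γ x ν r (j + + 1) → Γ x ν r (j - + 1) → ¬ Corner x ν r j
  ¬Corner-vertical {r} {j} above below (_ , no-opposite-pair) =
    no-opposite-pair r (j + + 1) above (i+1≢i j ∘ proj₂)
      (subst₂ (Γ x ν) (i≡2i-i r) (i-k≡2i-[i+k] j (+ 1)) below)
    where
    i≡2i-i : ∀ i → i ≡ + 2 * i - i
    i≡2i-i = solve-∀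

  ¬Corner-sideways : ∀ {r j p q} → Γ x ν (r + + 1) p → Γ x ν (r - + 1) q → p + q ≡ + 2 * j →
                     ¬ Corner x ν r j
  ¬Corner-sideways {r} {j} {p} {q} right left p+q≡2j (_ , no-opposite-pair) =
    no-opposite-pair (r + + 1) p right (i+1≢i r ∘ proj₁)
      (subst₂ (Γ x ν) (i-k≡2i-[i+k] r (+ 1)) (trans (q≡[p+q]-p p q) (cong (_- p) p+q≡2j)) left)
    where
    q≡[p+q]-p : ∀ p q → q ≡ (p + q) - p
    q≡[p+q]-p = solve-∀

  -- If x⁻¹β has positive π-coefficient, its being negative forces its affine part to be
  -- negative, so the whole column above the π-axis lies in Γ.
  corner⇒height≤0 : ∀ {r j} → Corner x ν r j → + 1 < j → height r j ≤ + 0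
  corner⇒height≤0 {r} {j} corner@((β>0 , x⁻¹β≯0) , _) 1<j =
    ≮⇒≥ λ 0<h → ¬Corner-vertical (column 0<h (1<i⇒0<i+1 1<j)) (column 0<h (1<i⇒0<i-1 1<j)) corner
    where
    column : + 0 < height r j → ∀ {q} → + 0 < q → Γ x ν r q
    column 0<h 0<q = DPos-raise β>0 0<q , λ γ>0 → x⁻¹β≯0 (DPos-raise γ>0 0<h)

  corner⇒-1≤height : ∀ {r j} → Corner x ν r j → + 1 < j → -[1+ 0 ] ≤ height r j
  corner⇒-1≤height {r} {j} corner@((β>0 , _) , _) 1<j =
    ≮⇒≥ λ h<-1 → ¬Corner-vertical
      (DPos-raise β>0 (1<i⇒0<i+1 1<j) ,
       j<0⇒¬DPos (subst (_< + 0) (sym (height-suc j (line r))) (+-monoˡ-< (+ 1) h<-1)))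
      (DPos-raise β>0 (1<i⇒0<i-1 1<j) ,
       j<0⇒¬DPos (subst (_< + 0) (sym (height-pred j (line r))) (<-trans (+-monoˡ-< (- + 1) h<-1) -<+)))
      corner
    where
    height-suc : ∀ j L → (j + + 1) - L ≡ (j - L) + + 1
    height-suc = solve-∀
    height-pred : ∀ j L → (j - + 1) - L ≡ (j - L) - + 1
    height-pred = solve-∀

  corner-cases : ∀ {r j} → Corner x ν r j →
                 (j ≡ + 0 ⊎ j ≡ + 1) ⊎ (-[1+ 0 ] ≤ height r j × height r j ≤ + 0)
  corner-cases {r} {j} corner@((β>0 , _) , _) with j ≤? + 1
  ... | yes j≤1 = inj₁ (0≤i≤1⇒i≡0∨i≡1 (DPos⇒0≤j β>0) j≤1)
  ... | no j≰1 = inj₂ (corner⇒-1≤height corner (≰⇒> j≰1) , corner⇒height≤0 corner (≰⇒> j≰1))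

  rows : ℤ → List ℤ
  rows r = + 0 ∷ + 1 ∷ line r ∷ line r - + 1 ∷ []

  corner⇒row : ∀ {r j} → Corner x ν r j → j ∈ rows r
  corner⇒row {r} {j} corner with corner-cases corner
  ... | inj₁ (inj₁ j≡0) = here j≡0
  ... | inj₁ (inj₂ j≡1) = there (here j≡1)
  ... | inj₂ (-1≤h , h≤0) with -1≤i≤0⇒i≡0∨i≡-1 -1≤h h≤0
  ...   | inj₁ h≡0 = there (there (here (begin
          j                    ≡⟨ j≡height+line r j ⟩
          height r j + line r  ≡⟨ cong (_+ line r) h≡0 ⟩
          + 0 + line r         ≡⟨ +-identityˡ (line r) ⟩
          line r               ∎)))
  ...   | inj₂ h≡-1 = there (there (there (here (begin
          j                    ≡⟨ j≡height+line r j ⟩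
          height r j + line r  ≡⟨ cong (_+ line r) h≡-1 ⟩
          -[1+ 0 ] + line r    ≡⟨ +-comm -[1+ 0 ] (line r) ⟩
          line r - + 1         ∎))))

  upper : ℤ
  upper = a ⊔ (+ 0 ⊔ c)

  Γ⇒r≤upper : ∀ {r j} → Γ x ν r j → r ≤ upper
  Γ⇒r≤upper {r} {j} (β>0 , x⁻¹β≯0) with r ≤? a | r ≤? + 0
  ... | yes r≤a | _ = i≤j⇒i≤j⊔k (+ 0 ⊔ c) r≤a
  ... | no _ | yes r≤0 = i≤j⇒i≤k⊔j a (i≤j⇒i≤j⊔k c r≤0)
  ... | no r≰a | no r≰0 = i≤j⇒i≤k⊔j a (i≤j⇒i≤k⊔j (+ 0) (<⇒≤ r<c))
    where
    height<0 : height r j < + 0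
    height<0 = ≰⇒> λ 0≤h → x⁻¹β≯0 (0<r⇒0≤j⇒DPos (i<j⇒0<j-i (≰⇒> r≰a)) 0≤h)
    r<c : r < c
    r<c = 0<i-j⇒j<i (≤-<-trans (DPos⇒0≤j β>0)
            (<-≤-trans (i-j<0⇒i<j height<0) (line≤c-r (<⇒≤ (≰⇒> r≰0)))))

  farLeft : ℤ
  farLeft = (+ 0 ⊓ a) ⊓ (c - + 1)

  <farLeft⇒<0 : ∀ {s} → s < farLeft → s < + 0
  <farLeft⇒<0 s<b = <-≤-trans s<b (≤-trans (i⊓j≤i _ _) (i⊓j≤i _ _))

  <farLeft⇒<a : ∀ {s} → s < farLeft → s < a
  <farLeft⇒<a s<b = <-≤-trans s<b (≤-trans (i⊓j≤i _ _) (i⊓j≤j _ _))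

  <farLeft⇒1<line : ∀ {s} → s < farLeft → + 1 < line s
  <farLeft⇒1<line {s} s<b = <-≤-trans 1<c-s (c-r≤line (<⇒≤ (<farLeft⇒<0 s<b)))
    where
    s+[1-s]≡1 : ∀ s → s + (+ 1 - s) ≡ + 1
    s+[1-s]≡1 = solve-∀
    c-1+[1-s]≡c-s : ∀ c s → (c - + 1) + (+ 1 - s) ≡ c - s
    c-1+[1-s]≡c-s = solve-∀
    1<c-s : + 1 < c - s
    1<c-s = subst₂ _<_ (s+[1-s]≡1 s) (c-1+[1-s]≡c-s c s)
              (+-monoˡ-< (+ 1 - s) (<-≤-trans s<b (i⊓j≤j _ _)))

  <farLeft⇒Γ : ∀ {s q} → s < farLeft → + 0 < q → height s q ≤ + 0 → Γ x ν s q
  <farLeft⇒Γ s<b 0<q h≤0 =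
    r<0⇒0<j⇒DPos (<farLeft⇒<0 s<b) 0<q , r<0⇒j≤0⇒¬DPos (i<j⇒i-j<0 (<farLeft⇒<a s<b)) h≤0

  -- Far to the left a corner is the midpoint of two points of Γ in the neighbouring columns:
  -- on the row j = 1, or on the line of slope -l through it, along which the height is constant.
  ¬Corner-farLeft : ∀ {r j} → r + + 1 < farLeft → ¬ Corner x ν r j
  ¬Corner-farLeft {r} {j} r+1<b corner@((β>0 , _) , _) with corner-cases corner
  ... | inj₁ (inj₁ j≡0) =
    <-irrefl (sym j≡0) (r<0⇒DPos⇒0<j (<farLeft⇒<0 (≤-<-trans (i≤i+j r (+ 1)) r+1<b)) β>0)
  ... | inj₁ (inj₂ j≡1) =
    ¬Corner-sideways (on-row-1 r+1<b) (on-row-1 (≤-<-trans (i-1≤i+1 r) r+1<b)) (i+i≡2i j) corner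
    where
    i+i≡2i : ∀ i → i + i ≡ + 2 * i
    i+i≡2i = solve-∀
    on-row-1 : ∀ {s} → s < farLeft → Γ x ν s j
    on-row-1 s<b = subst (Γ x ν _) (sym j≡1)
      (<farLeft⇒Γ s<b (+<+ z<s) (<⇒≤ (i<j⇒i-j<0 (<farLeft⇒1<line s<b))))
  ... | inj₂ (-1≤h , h≤0) = ¬Corner-sideways {p = j - l} {q = j + l}
          (on-slope r+1<b (height-right c l r j))
          (on-slope (≤-<-trans (i-1≤i+1 r) r+1<b) (height-left c l r j))
          (i-k+[i+k]≡2i j l) corner
    where
    height-right : ∀ c l r j → (j - l) - (c + - l * (r + + 1)) ≡ j - (c + - l * r)
    height-right = solve-∀
    height-left : ∀ c l r j → (j + l) - (c + - l * (r - + 1)) ≡ j - (c + - l * r)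
    height-left = solve-∀
    i-k+[i+k]≡2i : ∀ i k → (i - k) + (i + k) ≡ + 2 * i
    i-k+[i+k]≡2i = solve-∀
    on-slope : ∀ {s q} → s < farLeft → height s q ≡ height r j → Γ x ν s q
    on-slope {s} {q} s<b same-height = <farLeft⇒Γ s<b 0<q (subst (_≤ + 0) (sym same-height) h≤0)
      where
      0<q : + 0 < q
      0<q = subst (+ 0 <_) (sym (j≡height+line s q))
              (+-mono-≤-< (subst (-[1+ 0 ] ≤_) (sym same-height) -1≤h) (<farLeft⇒1<line s<b))

  lower : ℤ
  lower = farLeft - + 1

  corner⇒lower≤r : ∀ {r j} → Corner x ν r j → lower ≤ r
  corner⇒lower≤r {r} corner = subst (lower ≤_) (i+1-1≡i r)
    (+-monoˡ-≤ (- + 1) (≮⇒≥ λ r+1<b → ¬Corner-farLeft r+1<b corner))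
    where
    i+1-1≡i : ∀ i → (i + + 1) - + 1 ≡ i
    i+1-1≡i = solve-∀

mainTheorem7 : ∀ {n : ℕ} (C : SimplyLacedCartan n) →
    let open RootData C in
    ∀ (x : WElt) (ν : Vecℤ n) → + 0 <ℤ level x → IsRoot ν →
    Σ (List (ℤ × ℤ)) λ L → ∀ r j → Corner x ν r j → (r , j) ∈ L
-- The argument never uses that ν is a root.
mainTheorem7 C x ν 0<l _ =
  bounded-with-finite-fibres⇒listed lower upper rows λ corner →
    corner⇒lower≤r corner , Γ⇒r≤upper (proj₁ corner) , corner⇒row corner
  where open CornerAnalysis C x ν 0<l
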